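{- Let $s(n)$ be the number of tournament sequences of length $n$. Then for all $n\geq 1$, $$s(n)\geq \alpha\,\frac{2^{\binom{n}{2}}}{(n-1)!},$$ where $\alpha=\prod_{i=1}^{\infty}\left(1-2^{ -i}\right)=(1-\tfrac12)(1-\tfrac14)(1-\tfrac18)\cdots\approx 0.28878837$.
   Context: A tournament sequence of length $n$ is a sequence of positive integers $(t_1,\ldots,t_n)$ with $t_1=1$ and $t_i<t_{i+1}\leq 2t_i$ for $1\leq i<n$. -}

module Defs where

open import Data.Nat as ℕ using (ℕ; zero; suc; _<_; _≤_; _*_; _^_)
open import Data.Nat.Combinatorics using (_C_)
open import Data.Nat.Base using (_!)
open import Data.Integer using (+_)
open import Data.Rational as ℚ using (ℚ; _/_)
open import Data.Vec using (Vec; []; _∷_)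
open import Data.Product using (_×_)
open import Data.Unit using (⊤)
open import Relation.Binary.PropositionalEquality using (_≡_)

Steps : ∀ {m} → ℕ → Vec ℕ m → Set
Steps a []       = ⊤
Steps a (b ∷ bs) = (a < b) × (b ≤ 2 * a) × Steps b bs

-- (t₁,…,tₙ) is a tournament sequence: t₁ = 1 and tᵢ < tᵢ₊₁ ≤ 2tᵢ
-- (positivity of all entries follows from t₁ = 1 and monotonicity)
IsTournament : ∀ {n} → Vec ℕ n → Set
IsTournament []       = ⊤
IsTournament (t ∷ ts) = (t ≡ 1) × Steps t ts

ℕ→ℚ : ℕ → ℚ
ℕ→ℚ k = (+ k) / 1

halfPow : ℕ → ℚ
halfPow zero    = ℚ.1ℚ
halfPow (suc i) = ((+ 1) / 2) ℚ.* halfPow i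

-- partial product P k = ∏_{i=1}^{k} (1 - 2^{-i});  α = lim P k = inf P k
P : ℕ → ℚ
P zero    = ℚ.1ℚ
P (suc k) = P k ℚ.* (ℚ.1ℚ ℚ.- halfPow (suc k))

twoPowBinom : ℕ → ℚ
twoPowBinom n = ℕ→ℚ (2 ^ (n C 2))

{-# OPTIONS --safe #-}
-- A tournament sequence of length k + 1 is 1 followed by a "step sequence" from 1, and the
-- number g(k, a) of step sequences of length k from a satisfies g(k + 1, a) = Σ_{a<b≤2a} g(k, b).
-- Telescoping (k + 1) b^k ≥ b^{k+1} − (b − 1)^{k+1} over (a, 2a] gives
-- (k + 1) Σ_{a<b≤2a} b^k ≥ (2^{k+1} − 1) a^{k+1}, so by induction k! g(k, a) ≥ Q_k a^k with
-- Q_k = ∏_{i=1}^{k} (2^i − 1). Since P k · 2^{binom(k+1,2)} = Q_k exactly, the bound holds with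
-- k = n − 1 for every m, without using the slack 1/(m+1).
module Submission where

open import Defs

module Counting where

  open import Data.Nat
  open import Data.Nat.Properties
  open import Data.Nat.ListAction using (sum)
  open import Data.Nat.Tactic.RingSolver using (solve-∀)
  open import Algebra.Properties.CommutativeSemigroup *-commutativeSemigroup using (x∙yz≈y∙xz)
  open import Data.List using (List; []; _∷_; [_]; map; concatMap; length)
  open import Data.List.Properties using (length-++; length-map; length-removeAt′)
  open import Data.List.Membership.Propositional using (_∈_)
  open import Data.List.Membership.Propositional.Properties using (∈-++⁻; ∈-map⁻)
  open import Data.List.Relation.Binary.Subset.Propositional using (_⊆_)
  open import Data.List.Relation.Unary.Any using (here; there; index; _─_)
  import Data.List.Relation.Unary.All as All
  open import Data.List.Relation.Unary.AllPairs using (_∷_)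
  open import Data.List.Relation.Unary.Unique.Propositional using (Unique; [])
  open import Data.List.Relation.Unary.Unique.Propositional.Properties using (++⁺; map⁺)
  open import Data.Vec using (Vec; []; _∷_)
  open import Data.Vec.Properties using (∷-injectiveʳ)
  open import Data.Product using (_×_; _,_; proj₁; ∃₂)
  open import Data.Sum using (inj₁; inj₂)
  open import Data.Unit using (tt)
  open import Function using (_∘_)
  open import Relation.Binary.PropositionalEquality using (_≡_; _≢_; refl; sym; trans; cong; cong₂)
  open import Relation.Nullary using (¬_; contradiction)

  module _ {A : Set} where

    ∈-─ : ∀ {x y : A} {ys} (x∈ys : x ∈ ys) → y ∈ ys → x ≢ y → y ∈ (ys ─ x∈ys)
    ∈-─ (here refl) (here refl)   x≢y = contradiction refl x≢y
    ∈-─ (here refl) (there y∈ys)  _   = y∈ys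
    ∈-─ (there _)   (here refl)   _   = here refl
    ∈-─ (there x∈ys) (there y∈ys) x≢y = there (∈-─ x∈ys y∈ys x≢y)

    Unique∧⊆⇒length-≤ : ∀ {xs ys : List A} → Unique xs → xs ⊆ ys → length xs ≤ length ys
    Unique∧⊆⇒length-≤ {[]}     _             _     = z≤n
    Unique∧⊆⇒length-≤ {x ∷ xs} {ys} (x∉xs ∷ xs!) xs⊆ys = begin
      suc (length xs)           ≤⟨ s≤s (Unique∧⊆⇒length-≤ xs! xs⊆ys─x) ⟩
      suc (length (ys ─ x∈ys))  ≡⟨ length-removeAt′ ys (index x∈ys) ⟨
      length ys                 ∎
      where
      open ≤-Reasoning
      x∈ys = xs⊆ys (here refl)
      xs⊆ys─x : xs ⊆ (ys ─ x∈ys)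
      xs⊆ys─x y∈xs = ∈-─ x∈ys (xs⊆ys (there y∈xs)) (All.lookup x∉xs y∈xs)

  module _ {A : Set} {k : ℕ} where

    consAll : List A → (A → List (Vec A k)) → List (Vec A (suc k))
    consAll bs ws = concatMap (λ b → map (b ∷_) (ws b)) bs

    ∈-consAll⁻ : ∀ bs ws {v} → v ∈ consAll bs ws → ∃₂ λ b w → b ∈ bs × w ∈ ws b × v ≡ b ∷ w
    ∈-consAll⁻ (b ∷ bs) ws v∈ with ∈-++⁻ (map (b ∷_) (ws b)) v∈
    ... | inj₁ v∈b∷ws with w , w∈ , refl ← ∈-map⁻ (b ∷_) v∈b∷ws = b , w , here refl , w∈ , refl
    ... | inj₂ v∈rest with b′ , w , b′∈ , w∈ , refl ← ∈-consAll⁻ bs ws v∈rest = b′ , w , there b′∈ , w∈ , refl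

    length-consAll : ∀ bs ws → length (consAll bs ws) ≡ sum (map (length ∘ ws) bs)
    length-consAll []       ws = refl
    length-consAll (b ∷ bs) ws = trans (length-++ (map (b ∷_) (ws b)))
      (cong₂ _+_ (length-map (b ∷_) (ws b)) (length-consAll bs ws))

    consAll-unique : ∀ {bs} ws → Unique bs → (∀ b → Unique (ws b)) → Unique (consAll bs ws)
    consAll-unique                  ws []           _   = []
    consAll-unique {b ∷ bs} ws (b∉bs ∷ bs!) ws! =
      ++⁺ (map⁺ ∷-injectiveʳ (ws! b)) (consAll-unique ws bs! ws!) disjoint
      where
      disjoint : ∀ {v} → ¬ (v ∈ map (b ∷_) (ws b) × v ∈ consAll bs ws)
      disjoint (v∈b∷ws , v∈rest) with _ , _ , refl ← ∈-map⁻ (b ∷_) v∈b∷ws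
        with _ , _ , b∈bs , _ , refl ← ∈-consAll⁻ bs ws v∈rest = All.lookup b∉bs b∈bs refl

  interval : ℕ → ℕ → List ℕ
  interval c zero    = []
  interval c (suc j) = suc c ∷ interval (suc c) j

  ∈-interval⁻ : ∀ c j {b} → b ∈ interval c j → c < b × b ≤ c + j
  ∈-interval⁻ c (suc j) (here refl) = ≤-refl , ≤-trans (m≤m+n (suc c) j) (≤-reflexive (sym (+-suc c j)))
  ∈-interval⁻ c (suc j) (there b∈) with c<b , b≤ ← ∈-interval⁻ (suc c) j b∈ =
    <-trans (n<1+n c) c<b , ≤-trans b≤ (≤-reflexive (sym (+-suc c j)))

  interval-unique : ∀ c j → Unique (interval c j)
  interval-unique c zero    = []
  interval-unique c (suc j) =
    All.tabulate (λ b∈ → <⇒≢ (proj₁ (∈-interval⁻ (suc c) j b∈))) ∷ interval-unique (suc c) j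

  stepsFrom : (k : ℕ) → ℕ → List (Vec ℕ k)
  stepsFrom zero    a = [ [] ]
  stepsFrom (suc k) a = consAll (interval a a) (stepsFrom k)

  ∈-stepsFrom⁻ : ∀ k a {v} → v ∈ stepsFrom k a → Steps a v
  ∈-stepsFrom⁻ zero    a (here refl) = tt
  ∈-stepsFrom⁻ (suc k) a v∈ with b , w , b∈ , w∈ , refl ← ∈-consAll⁻ (interval a a) (stepsFrom k) v∈
    with a<b , b≤a+a ← ∈-interval⁻ a a b∈ =
    a<b , ≤-trans b≤a+a (≤-reflexive (cong (a +_) (sym (+-identityʳ a)))) , ∈-stepsFrom⁻ k b w∈

  stepsFrom-unique : ∀ k a → Unique (stepsFrom k a)
  stepsFrom-unique zero    a = All.[] ∷ []
  stepsFrom-unique (suc k) a = consAll-unique (stepsFrom k) (interval-unique a a) (stepsFrom-unique k)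

  mersenneProduct : ℕ → ℕ
  mersenneProduct zero    = 1
  mersenneProduct (suc k) = mersenneProduct k * (2 ^ suc k ∸ 1)

  [m+m]^n≡2^n*m^n : ∀ m n → (m + m) ^ n ≡ 2 ^ n * m ^ n
  [m+m]^n≡2^n*m^n m zero    = refl
  [m+m]^n≡2^n*m^n m (suc n) = trans (cong ((m + m) *_) ([m+m]^n≡2^n*m^n m n)) (regroup m (2 ^ n) (m ^ n))
    where
    regroup : ∀ m p q → (m + m) * (p * q) ≡ (2 * p) * (m * q)
    regroup = solve-∀

  [1+m]^[1+n]≤m^[1+n]+[1+n]*[1+m]^n : ∀ m n → suc m ^ suc n ≤ m ^ suc n + suc n * suc m ^ n
  [1+m]^[1+n]≤m^[1+n]+[1+n]*[1+m]^n m zero    = ≤-reflexive (base m)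
    where
    base : ∀ m → suc m * 1 ≡ m * 1 + 1 * 1
    base = solve-∀
  [1+m]^[1+n]≤m^[1+n]+[1+n]*[1+m]^n m (suc n) = begin
    suc m * suc m ^ suc n                         ≤⟨ *-monoʳ-≤ (suc m) ([1+m]^[1+n]≤m^[1+n]+[1+n]*[1+m]^n m n) ⟩
    suc m * (m ^ suc n + suc n * suc m ^ n)       ≡⟨ expand m (m ^ suc n) (suc m ^ n) n ⟩
    m ^ suc (suc n) + m ^ suc n + suc n * suc m ^ suc n
      ≤⟨ +-monoˡ-≤ _ (+-monoʳ-≤ (m ^ suc (suc n)) (^-monoˡ-≤ (suc n) (n≤1+n m))) ⟩
    m ^ suc (suc n) + suc m ^ suc n + suc n * suc m ^ suc n ≡⟨ +-assoc (m ^ suc (suc n)) _ _ ⟩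
    m ^ suc (suc n) + suc (suc n) * suc m ^ suc n ∎
    where
    open ≤-Reasoning
    expand : ∀ m x y n → suc m * (x + suc n * y) ≡ m * x + x + suc n * (suc m * y)
    expand = solve-∀

  telescope-≤ : ∀ (f g : ℕ → ℕ) → (∀ x → f (suc x) ≤ f x + g (suc x)) →
                ∀ c j → f (c + j) ≤ f c + sum (map g (interval c j))
  telescope-≤ f g step c zero    = ≤-reflexive (trans (cong f (+-identityʳ c)) (sym (+-identityʳ (f c))))
  telescope-≤ f g step c (suc j) = begin
    f (c + suc j)                               ≡⟨ cong f (+-suc c j) ⟩
    f (suc c + j)                               ≤⟨ telescope-≤ f g step (suc c) j ⟩
    f (suc c) + sum (map g (interval (suc c) j)) ≤⟨ +-monoˡ-≤ _ (step c) ⟩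
    f c + g (suc c) + sum (map g (interval (suc c) j)) ≡⟨ +-assoc (f c) _ _ ⟩
    f c + sum (map g (interval c (suc j)))      ∎
    where open ≤-Reasoning

  [2^[1+k]∸1]*a^[1+k]≤sum : ∀ k a →
                            (2 ^ suc k ∸ 1) * a ^ suc k ≤ sum (map (λ b → suc k * b ^ k) (interval a a))
  [2^[1+k]∸1]*a^[1+k]≤sum k a = begin
    (2 ^ suc k ∸ 1) * a ^ suc k   ≡⟨ *-distribʳ-∸ (a ^ suc k) (2 ^ suc k) 1 ⟩
    2 ^ suc k * a ^ suc k ∸ 1 * a ^ suc k
      ≡⟨ cong₂ _∸_ (sym ([m+m]^n≡2^n*m^n a (suc k))) (*-identityˡ (a ^ suc k)) ⟩
    (a + a) ^ suc k ∸ a ^ suc k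
      ≤⟨ m≤n+o⇒m∸n≤o _ (a ^ suc k) (telescope-≤ (_^ suc k) _ (λ x → [1+m]^[1+n]≤m^[1+n]+[1+n]*[1+m]^n x k) a a) ⟩
    sum (map (λ b → suc k * b ^ k) (interval a a)) ∎
    where open ≤-Reasoning

  *-sum-mono-≤ : ∀ m n (f g : ℕ → ℕ) xs → (∀ x → m * f x ≤ n * g x) →
                 m * sum (map f xs) ≤ n * sum (map g xs)
  *-sum-mono-≤ m n f g []       _  = ≤-reflexive (trans (*-zeroʳ m) (sym (*-zeroʳ n)))
  *-sum-mono-≤ m n f g (x ∷ xs) le = begin
    m * (f x + sum (map f xs))       ≡⟨ *-distribˡ-+ m (f x) _ ⟩
    m * f x + m * sum (map f xs)     ≤⟨ +-mono-≤ (le x) (*-sum-mono-≤ m n f g xs le) ⟩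
    n * g x + n * sum (map g xs)     ≡⟨ *-distribˡ-+ n (g x) _ ⟨
    n * (g x + sum (map g xs))       ∎
    where open ≤-Reasoning

  mersenneProduct*a^k≤k!*|stepsFrom| : ∀ k a → mersenneProduct k * a ^ k ≤ k ! * length (stepsFrom k a)
  mersenneProduct*a^k≤k!*|stepsFrom| zero    a = ≤-refl
  mersenneProduct*a^k≤k!*|stepsFrom| (suc k) a = begin
    mersenneProduct k * (2 ^ suc k ∸ 1) * a ^ suc k   ≡⟨ *-assoc (mersenneProduct k) _ _ ⟩
    mersenneProduct k * ((2 ^ suc k ∸ 1) * a ^ suc k) ≤⟨ *-monoʳ-≤ (mersenneProduct k) ([2^[1+k]∸1]*a^[1+k]≤sum k a) ⟩
    mersenneProduct k * sum (map (λ b → suc k * b ^ k) I)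
      ≤⟨ *-sum-mono-≤ (mersenneProduct k) (suc k !) _ _ I termwise ⟩
    suc k ! * sum (map (length ∘ stepsFrom k) I)      ≡⟨ cong (suc k ! *_) (length-consAll I (stepsFrom k)) ⟨
    suc k ! * length (stepsFrom (suc k) a)            ∎
    where
    open ≤-Reasoning
    I = interval a a
    termwise : ∀ b → mersenneProduct k * (suc k * b ^ k) ≤ suc k ! * length (stepsFrom k b)
    termwise b = begin
      mersenneProduct k * (suc k * b ^ k)   ≡⟨ x∙yz≈y∙xz (mersenneProduct k) (suc k) (b ^ k) ⟩
      suc k * (mersenneProduct k * b ^ k)   ≤⟨ *-monoʳ-≤ (suc k) (mersenneProduct*a^k≤k!*|stepsFrom| k b) ⟩
      suc k * (k ! * length (stepsFrom k b)) ≡⟨ *-assoc (suc k) (k !) _ ⟨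
      suc k ! * length (stepsFrom k b)      ∎

  mersenneProduct≤|L|*k! : ∀ k (L : List (Vec ℕ (suc k))) → (∀ t → IsTournament t → t ∈ L) →
                           mersenneProduct k ≤ length L * k !
  mersenneProduct≤|L|*k! k L tournaments⊆L = begin
    mersenneProduct k                          ≡⟨ trans (cong (mersenneProduct k *_) (^-zeroˡ k)) (*-identityʳ _) ⟨
    mersenneProduct k * 1 ^ k                  ≤⟨ mersenneProduct*a^k≤k!*|stepsFrom| k 1 ⟩
    k ! * length (stepsFrom k 1)               ≡⟨ cong (k ! *_) (length-map (1 ∷_) (stepsFrom k 1)) ⟨
    k ! * length (map (1 ∷_) (stepsFrom k 1))  ≤⟨ *-monoʳ-≤ (k !) (Unique∧⊆⇒length-≤ unique ⊆L) ⟩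
    k ! * length L                             ≡⟨ *-comm (k !) (length L) ⟩
    length L * k !                             ∎
    where
    open ≤-Reasoning
    unique : Unique (map (1 ∷_) (stepsFrom k 1))
    unique = map⁺ ∷-injectiveʳ (stepsFrom-unique k 1)
    ⊆L : map (1 ∷_) (stepsFrom k 1) ⊆ L
    ⊆L t∈ with w , w∈ , refl ← ∈-map⁻ (1 ∷_) t∈ = tournaments⊆L (1 ∷ w) (refl , ∈-stepsFrom⁻ k 1 w∈)

module Rational where

  open import Data.Nat as ℕ using (zero; suc)
  import Data.Nat.Properties as ℕ
  open import Data.Nat.Combinatorics using (_C_; nCk+nC[k+1]≡[n+1]C[k+1]; nC1≡n)
  open import Data.Nat.Coprimality using (1-coprimeTo)
  import Data.Nat.Coprimality as Coprime
  open import Data.Integer as ℤ using (+_)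
  import Data.Integer.Properties as ℤ
  open import Data.Rational using (mkℚ; _/_; NonNegative; _≤_; _*_; _+_; _-_; 1ℚ; ½)
  open import Data.Rational.Properties
    using (normalize-coprime; normalize-nonNeg; nonNegative⁻¹; +-identityʳ; +-monoʳ-≤; ≤-trans; ≤-reflexive; module ≤-Reasoning)
  open import Data.Rational.Solver using (module +-*-Solver)
  open import Relation.Binary.PropositionalEquality using (_≡_; refl; sym; trans; cong; cong₂; module ≡-Reasoning)
  open Counting using (mersenneProduct)

  open +-*-Solver

  p≤p+q : ∀ p q .{{_ : NonNegative q}} → p ≤ p + q
  p≤p+q p q = ≤-trans (≤-reflexive (sym (+-identityʳ p))) (+-monoʳ-≤ p (nonNegative⁻¹ q))

  ℕ→ℚ≡mkℚ : ∀ n → ℕ→ℚ n ≡ mkℚ (+ n) 0 (Coprime.sym (1-coprimeTo n))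
  ℕ→ℚ≡mkℚ n = normalize-coprime _

  -- On denominators 1, ℚ's _+_ and _*_ compute to the integer operations over 1.
  ℕ→ℚ-* : ∀ m n → ℕ→ℚ (m ℕ.* n) ≡ ℕ→ℚ m * ℕ→ℚ n
  ℕ→ℚ-* m n = trans (cong (_/ 1) (ℤ.pos-* m n)) (sym (cong₂ _*_ (ℕ→ℚ≡mkℚ m) (ℕ→ℚ≡mkℚ n)))

  ℕ→ℚ-+ : ∀ m n → ℕ→ℚ (m ℕ.+ n) ≡ ℕ→ℚ m + ℕ→ℚ n
  ℕ→ℚ-+ m n = trans (cong (_/ 1) numerator) (sym (cong₂ _+_ (ℕ→ℚ≡mkℚ m) (ℕ→ℚ≡mkℚ n)))
    where
    numerator : + (m ℕ.+ n) ≡ + m ℤ.* + 1 ℤ.+ + n ℤ.* + 1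
    numerator = trans (ℤ.pos-+ m n) (sym (cong₂ ℤ._+_ (ℤ.*-identityʳ (+ m)) (ℤ.*-identityʳ (+ n))))

  ℕ→ℚ-∸ : ∀ {m n} → n ℕ.≤ m → ℕ→ℚ (m ℕ.∸ n) ≡ ℕ→ℚ m - ℕ→ℚ n
  ℕ→ℚ-∸ {m} {n} n≤m = begin
    ℕ→ℚ (m ℕ.∸ n)                           ≡⟨ solve 2 (λ x y → x := (x :+ y) :- y) refl (ℕ→ℚ (m ℕ.∸ n)) (ℕ→ℚ n) ⟩
    (ℕ→ℚ (m ℕ.∸ n) + ℕ→ℚ n) - ℕ→ℚ n         ≡⟨ cong (_- ℕ→ℚ n) (ℕ→ℚ-+ (m ℕ.∸ n) n) ⟨
    ℕ→ℚ (m ℕ.∸ n ℕ.+ n) - ℕ→ℚ n             ≡⟨ cong (λ k → ℕ→ℚ k - ℕ→ℚ n) (ℕ.m∸n+n≡m n≤m) ⟩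
    ℕ→ℚ m - ℕ→ℚ n                           ∎
    where open ≡-Reasoning

  ℕ→ℚ-mono-≤ : ∀ {m n} → m ℕ.≤ n → ℕ→ℚ m ≤ ℕ→ℚ n
  ℕ→ℚ-mono-≤ {m} {n} m≤n = begin
    ℕ→ℚ m                        ≤⟨ p≤p+q (ℕ→ℚ m) (ℕ→ℚ (n ℕ.∸ m)) {{normalize-nonNeg (n ℕ.∸ m) 1}} ⟩
    ℕ→ℚ m + ℕ→ℚ (n ℕ.∸ m)        ≡⟨ ℕ→ℚ-+ m (n ℕ.∸ m) ⟨
    ℕ→ℚ (m ℕ.+ (n ℕ.∸ m))        ≡⟨ cong ℕ→ℚ (ℕ.m+[n∸m]≡n m≤n) ⟩
    ℕ→ℚ n                        ∎
    where open ≤-Reasoning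

  halfPow*2^≡1 : ∀ i → halfPow i * ℕ→ℚ (2 ℕ.^ i) ≡ 1ℚ
  halfPow*2^≡1 zero    = refl
  halfPow*2^≡1 (suc i) = begin
    (½ * halfPow i) * ℕ→ℚ (2 ℕ.* 2 ℕ.^ i)         ≡⟨ cong ((½ * halfPow i) *_) (ℕ→ℚ-* 2 (2 ℕ.^ i)) ⟩
    (½ * halfPow i) * (ℕ→ℚ 2 * ℕ→ℚ (2 ℕ.^ i))     ≡⟨ solve 4 (λ a h b t → (a :* h) :* (b :* t) := (a :* b) :* (h :* t)) refl
                                                       ½ (halfPow i) (ℕ→ℚ 2) (ℕ→ℚ (2 ℕ.^ i)) ⟩
    (½ * ℕ→ℚ 2) * (halfPow i * ℕ→ℚ (2 ℕ.^ i))     ≡⟨ cong (1ℚ *_) (halfPow*2^≡1 i) ⟩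
    1ℚ * 1ℚ                                       ≡⟨⟩
    1ℚ                                            ∎
    where open ≡-Reasoning

  [2+k]C2≡[1+k]+[1+k]C2 : ∀ k → suc (suc k) C 2 ≡ suc k ℕ.+ suc k C 2
  [2+k]C2≡[1+k]+[1+k]C2 k =
    trans (sym (nCk+nC[k+1]≡[n+1]C[k+1] (suc k) 1)) (cong (ℕ._+ suc k C 2) (nC1≡n (suc k)))

  P*twoPowBinom≡mersenneProduct : ∀ k → P k * twoPowBinom (suc k) ≡ ℕ→ℚ (mersenneProduct k)
  P*twoPowBinom≡mersenneProduct zero    = refl
  P*twoPowBinom≡mersenneProduct (suc k) = begin
    P k * (1ℚ - h) * ℕ→ℚ (2 ℕ.^ (suc (suc k) C 2))  ≡⟨ cong (λ e → P k * (1ℚ - h) * ℕ→ℚ e) 2^[2+k]C2≡T*Y ⟩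
    P k * (1ℚ - h) * ℕ→ℚ (T ℕ.* Y)                  ≡⟨ cong (P k * (1ℚ - h) *_) (ℕ→ℚ-* T Y) ⟩
    P k * (1ℚ - h) * (ℕ→ℚ T * ℕ→ℚ Y)               ≡⟨ solve 4 (λ p h t y → p :* (con 1ℚ :- h) :* (t :* y) := (p :* y) :* (t :- h :* t)) refl
                                                        (P k) h (ℕ→ℚ T) (ℕ→ℚ Y) ⟩
    (P k * ℕ→ℚ Y) * (ℕ→ℚ T - h * ℕ→ℚ T)           ≡⟨ cong₂ (λ q r → q * (ℕ→ℚ T - r)) (P*twoPowBinom≡mersenneProduct k) (halfPow*2^≡1 (suc k)) ⟩
    ℕ→ℚ (mersenneProduct k) * (ℕ→ℚ T - 1ℚ)         ≡⟨ cong (ℕ→ℚ (mersenneProduct k) *_) (ℕ→ℚ-∸ (ℕ.m^n>0 2 (suc k))) ⟨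
    ℕ→ℚ (mersenneProduct k) * ℕ→ℚ (T ℕ.∸ 1)        ≡⟨ ℕ→ℚ-* (mersenneProduct k) (T ℕ.∸ 1) ⟨
    ℕ→ℚ (mersenneProduct (suc k))                  ∎
    where
    open ≡-Reasoning
    h = halfPow (suc k)
    T = 2 ℕ.^ suc k
    Y = 2 ℕ.^ (suc k C 2)
    2^[2+k]C2≡T*Y : 2 ℕ.^ (suc (suc k) C 2) ≡ T ℕ.* Y
    2^[2+k]C2≡T*Y = trans (cong (2 ℕ.^_) ([2+k]C2≡[1+k]+[1+k]C2 k)) (ℕ.^-distribˡ-+-* 2 (suc k) _)

open import Data.Nat using (ℕ; suc; _≥_; _∸_)
open import Data.Nat.Base using (_!)
open import Data.Integer using (+_)
open import Data.Rational using (_/_; _≤_; _*_; _+_)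
open import Data.Vec using (Vec)
open import Data.List using (List; length)
open import Data.List.Membership.Propositional using (_∈_)
open import Data.List.Relation.Unary.Unique.Propositional using (Unique)
open import Data.Product using (∃)
open import Function.Bundles using (_⇔_)
open import Data.Product using (_,_)
open import Function.Bundles using (module Equivalence)
open import Data.Rational.Properties using (normalize-nonNeg; *-monoʳ-≤-nonNeg; module ≤-Reasoning)
open Counting using (mersenneProduct; mersenneProduct≤|L|*k!)
open Rational using (ℕ→ℚ-*; ℕ→ℚ-mono-≤; p≤p+q; P*twoPowBinom≡mersenneProduct)
import Data.Nat as ℕ

lemma3 : (n : ℕ) → n ≥ 1 →
    (L : List (Vec ℕ n)) → Unique L → (∀ t → t ∈ L ⇔ IsTournament t) →
    ∀ (m : ℕ) → ∃ λ (k : ℕ) →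
      P k * twoPowBinom n ≤ (ℕ→ℚ (length L) + (+ 1) / suc m) * ℕ→ℚ ((n ∸ 1) !)
lemma3 (suc k) _ L _ L⇔tournament m = k , (begin
  P k * twoPowBinom (suc k)                  ≡⟨ P*twoPowBinom≡mersenneProduct k ⟩
  ℕ→ℚ (mersenneProduct k)                    ≤⟨ ℕ→ℚ-mono-≤ (mersenneProduct≤|L|*k! k L tournament⇒∈L) ⟩
  ℕ→ℚ (length L ℕ.* k !)                     ≡⟨ ℕ→ℚ-* (length L) (k !) ⟩
  ℕ→ℚ (length L) * ℕ→ℚ (k !)                 ≤⟨ *-monoʳ-≤-nonNeg (ℕ→ℚ (k !)) {{normalize-nonNeg (k !) 1}}
                                                  (p≤p+q (ℕ→ℚ (length L)) ((+ 1) / suc m) {{normalize-nonNeg 1 (suc m)}}) ⟩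
  (ℕ→ℚ (length L) + (+ 1) / suc m) * ℕ→ℚ (k !) ∎)
  where
  open ≤-Reasoning
  tournament⇒∈L : ∀ t → IsTournament t → t ∈ L
  tournament⇒∈L t = Equivalence.from (L⇔tournament t)
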